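{- Let $p$ be an odd prime and $a\in\mathbf{F}_p$. Then $h_p(\langle 1,a\rangle)=(p+1)/2$ if and only if $a=(p-1)/2+p\mathbf{Z}$ or $a=p-2+p\mathbf{Z}$. Moreover, if $a\notin\{(p-1)/2+p\mathbf{Z},\ p-2+p\mathbf{Z},\ p-1+p\mathbf{Z}\}$, then $h_p(\langle 1,a\rangle)\le \frac{p-1}{2}$.
   Context: $\mathbf{F}_p=\mathbf{Z}/p\mathbf{Z}$. $\mathbf{P}^{1}(\mathbf{F}_p)$ is the set of equivalence classes $\langle a_1,a_2\rangle$ of nonzero pairs in $\mathbf{F}_p^2$ under $(a_1,a_2)\sim(ka_1,ka_2)$ for $k\in\mathbf{F}_p\setminus\{0\}$. For $x\in\mathbf{F}_p$, $x \bmod p$ denotes the least nonnegative integer in the class $x$. The height of $\langle a_1,a_2\rangle$ is $h_p(\langle a_1,a_2\rangle)=\min\{(ka_1\bmod p)+(ka_2 \bmod p): k=1,\ldots,p-1\}$; in particular $h_p(\langle 1,a\rangle)=\min\{k+(ka\bmod p):k=1,\ldots,p-1\}$. -}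

module Defs where

open import Data.Nat using (ℕ; zero; suc; _+_; _*_; _∸_; _⊓_; NonZero)
open import Data.Nat.DivMod using (_%_)
open import Data.Fin using (Fin; toℕ)

minFrom1 : (ℕ → ℕ) → ℕ → ℕ
minFrom1 f zero          = f zero
minFrom1 f (suc zero)    = f 1
minFrom1 f (suc (suc n)) = minFrom1 f (suc n) ⊓ f (suc (suc n))

-- Elements of F_p are represented by Fin p (least nonnegative residues),
-- so for a : Fin p, "a mod p" is toℕ a.
-- h_p(⟨1,a⟩) = min { k + (k a mod p) : k = 1, …, p - 1 }
h1 : (p : ℕ) .{{_ : NonZero p}} → Fin p → ℕ
h1 p a = minFrom1 (λ k → k + (k * toℕ a) % p) (p ∸ 1)

{-# OPTIONS --safe #-}
-- For p = 2m + 1 and k ≥ 1, write r = k a mod p.  For a = m, a = p - 2 and a = p - 1 the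
-- relations 2a + 1 = p, a + 2 = p, a + 1 = p make p divide 2r + k, r + 2k, r + k respectively,
-- which forces k + r ≥ m + 1 (and even k + r ≥ p in the last case); k = 1 and k = m attain
-- m + 1 in the first two cases.  For any other a, either a < m and k = 1 gives a + 1 ≤ m, or
-- b = p - a satisfies 3 ≤ b ≤ m: dividing p = r + k b with r < b, we get k a ≡ r (mod p) and
-- 2 (k + r) ≤ r + k b = p, so k + r ≤ m since p is odd.  Primality is only used to make p odd.
module Submission where

open import Defs
open import Data.Nat using (ℕ; _+_; _∸_; _≤_; _/_; NonZero)
open import Data.Nat.Primality using (Prime)
open import Data.Fin using (Fin; toℕ)
open import Data.Product using (_×_)
open import Data.Sum using (_⊎_)
open import Relation.Nullary using (¬_)
open import Relation.Binary.PropositionalEquality using (_≡_; _≢_)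

open import Data.Nat using (zero; suc; _*_; _<_; _%_; z≤n; s≤s; s≤s⁻¹; >-nonZero; _≟_; _<?_; nonTrivial⇒≢1)
open import Data.Nat.Properties
open import Data.Nat.DivMod using (m≡m%n+[m/n]*n; [m+kn]%n≡m%n; m<n⇒m%n≡m; m*n/n≡m; m%n<n)
open import Data.Nat.Divisibility using (_∣_; divides; ∣m+n∣m⇒∣n; ∣⇒≤)
open import Data.Nat.Primality using (prime⇒irreducible; prime⇒nonTrivial)
open import Data.Nat.Tactic.RingSolver using (solve-∀)
open import Data.Fin.Properties using (toℕ<n)
open import Data.Product using (_,_; ∃-syntax)
open import Data.Sum using (inj₁; inj₂; [_,_]′)
open import Relation.Nullary using (yes; no; contradiction)
open import Relation.Binary.PropositionalEquality using (refl; sym; trans; cong; module ≡-Reasoning)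

minFrom1-≤ : ∀ f n {k} → 1 ≤ k → k ≤ n → minFrom1 f n ≤ f k
minFrom1-≤ f zero          {suc _}       _ ()
minFrom1-≤ f (suc zero)    {suc zero}    _ _ = ≤-refl
minFrom1-≤ f (suc zero)    {suc (suc _)} _ (s≤s ())
minFrom1-≤ f (suc (suc n)) 1≤k k≤n =
  [ (λ k<n → ≤-trans (m⊓n≤m _ _) (minFrom1-≤ f (suc n) 1≤k (s≤s⁻¹ k<n))) , (λ { refl → m⊓n≤n _ _ }) ]′
  (m≤n⇒m<n∨m≡n k≤n)

minFrom1-greatest : ∀ f n {c} → 1 ≤ n → (∀ k → 1 ≤ k → k ≤ n → c ≤ f k) → c ≤ minFrom1 f n
minFrom1-greatest f (suc zero)    _ c≤f = c≤f 1 ≤-refl ≤-refl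
minFrom1-greatest f (suc (suc n)) _ c≤f =
  ⊓-glb (minFrom1-greatest f (suc n) (s≤s z≤n) (λ k 1≤k k≤n → c≤f k 1≤k (m≤n⇒m≤1+n k≤n)))
        (c≤f (suc (suc n)) (s≤s z≤n) ≤-refl)

heightAt : (p : ℕ) .{{_ : NonZero p}} → ℕ → ℕ → ℕ
heightAt p x k = k + (k * x) % p

height : (p : ℕ) .{{_ : NonZero p}} → ℕ → ℕ
height p x = minFrom1 (heightAt p x) (p ∸ 1)

height-≤ : ∀ p .{{_ : NonZero p}} x {k} → 1 ≤ k → k < p → height p x ≤ heightAt p x k
height-≤ p x 1≤k k<p = minFrom1-≤ (heightAt p x) (p ∸ 1) 1≤k (<⇒≤pred k<p)

height-greatest : ∀ p .{{_ : NonZero p}} x {c} → 1 < p →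
                  (∀ k → 1 ≤ k → c ≤ heightAt p x k) → c ≤ height p x
height-greatest p x 1<p c≤h = minFrom1-greatest (heightAt p x) (p ∸ 1) (<⇒≤pred 1<p) (λ k 1≤k _ → c≤h k 1≤k)

m≡r+q*n⇒m%n≡r : ∀ {m n} .{{_ : NonZero n}} r q → m ≡ r + q * n → r < n → m % n ≡ r
m≡r+q*n⇒m%n≡r {n = n} r q refl r<n = trans ([m+kn]%n≡m%n r q n) (m<n⇒m%n≡m r<n)

heightAt-1 : ∀ {p} .{{_ : NonZero p}} {x} → x < p → heightAt p x 1 ≡ suc x
heightAt-1 {x = x} x<p = cong suc (m≡r+q*n⇒m%n≡r x 0 refl x<p)

c*x+d≡p⇒p≤c*r+d*k : ∀ {p} .{{_ : NonZero p}} c d x k → c * x + d ≡ p → 1 ≤ d → 1 ≤ k →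
                    p ≤ c * ((k * x) % p) + d * k
c*x+d≡p⇒p≤c*r+d*k {p} c d x k c*x+d≡p 1≤d 1≤k = ∣⇒≤ {{>-nonZero 0<c*r+d*k}} p∣c*r+d*k
  where
  r q : ℕ
  r = (k * x) % p
  q = (k * x) / p
  0<c*r+d*k : 0 < c * r + d * k
  0<c*r+d*k = ≤-trans (*-mono-≤ 1≤d 1≤k) (m≤n+m (d * k) (c * r))
  split : (c * q) * p + (c * r + d * k) ≡ k * p
  split = begin
    (c * q) * p + (c * r + d * k) ≡⟨ distribute c q p r d k ⟩
    c * (r + q * p) + d * k       ≡⟨ cong (λ t → c * t + d * k) (sym (m≡m%n+[m/n]*n (k * x) p)) ⟩
    c * (k * x) + d * k           ≡⟨ factor c k x d ⟩
    k * (c * x + d)               ≡⟨ cong (k *_) c*x+d≡p ⟩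
    k * p                         ∎
    where
    open ≡-Reasoning
    distribute : ∀ c q p r d k → (c * q) * p + (c * r + d * k) ≡ c * (r + q * p) + d * k
    distribute = solve-∀
    factor : ∀ c k x d → c * (k * x) + d * k ≡ k * (c * x + d)
    factor = solve-∀
  p∣c*r+d*k : p ∣ c * r + d * k
  p∣c*r+d*k = ∣m+n∣m⇒∣n (divides k split) (divides (c * q) refl)

height-half : ∀ {m} → 1 ≤ m → height (suc (m * 2)) m ≡ suc m
height-half {m} 1≤m = ≤-antisym upper (height-greatest p m 1<p lower)
  where
  p = suc (m * 2)
  1<p : 1 < p
  1<p = s≤s (≤-trans 1≤m (m≤m*n m 2))
  upper : height p m ≤ suc m
  upper = ≤-trans (height-≤ p m ≤-refl 1<p) (≤-reflexive (heightAt-1 (s≤s (m≤m*n m 2))))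
  lower : ∀ k → 1 ≤ k → suc m ≤ heightAt p m k
  lower k 1≤k = *-cancelʳ-≤ (suc m) (heightAt p m k) 2 (begin
      suc m * 2                         ≡⟨ solve₁ m ⟩
      p + 1                             ≤⟨ +-mono-≤ (c*x+d≡p⇒p≤c*r+d*k 2 1 m k (solve₂ m) ≤-refl 1≤k) 1≤k ⟩
      2 * ((k * m) % p) + 1 * k + k     ≡⟨ solve₃ ((k * m) % p) k ⟩
      (k + (k * m) % p) * 2             ∎)
    where
    open ≤-Reasoning
    solve₁ : ∀ m → suc m * 2 ≡ suc (m * 2) + 1
    solve₁ = solve-∀
    solve₂ : ∀ m → 2 * m + 1 ≡ suc (m * 2)
    solve₂ = solve-∀
    solve₃ : ∀ r k → 2 * r + 1 * k + k ≡ (k + r) * 2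
    solve₃ = solve-∀

height-minus2 : ∀ {m} → 1 ≤ m → height (suc (m * 2)) (m * 2 ∸ 1) ≡ suc m
height-minus2 {m@(suc n)} _ = ≤-antisym upper (height-greatest p x (s≤s (s≤s z≤n)) lower)
  where
  p x : ℕ
  p = suc (m * 2)
  x = suc (n * 2)
  -- k = m is the inverse of -2 = x modulo p
  m*x≡1+n*p : m * x ≡ 1 + n * p
  m*x≡1+n*p = solve n
    where
    solve : ∀ n → suc n * suc (n * 2) ≡ 1 + n * suc (suc n * 2)
    solve = solve-∀
  upper : height p x ≤ suc m
  upper = begin
    height p x      ≤⟨ height-≤ p x (s≤s z≤n) (s≤s (m≤m*n m 2)) ⟩
    m + (m * x) % p ≡⟨ cong (m +_) (m≡r+q*n⇒m%n≡r 1 n m*x≡1+n*p (s≤s (s≤s z≤n))) ⟩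
    m + 1           ≡⟨ +-comm m 1 ⟩
    suc m           ∎
    where open ≤-Reasoning
  lower : ∀ k → 1 ≤ k → suc m ≤ heightAt p x k
  lower k 1≤k with suc m ≤? k
  ... | yes m<k = ≤-trans m<k (m≤m+n k _)
  ... | no m≮k  = +-cancelʳ-≤ m (suc m) (heightAt p x k) (begin
      suc m + m                       ≡⟨ solve₁ m ⟩
      p                               ≤⟨ c*x+d≡p⇒p≤c*r+d*k 1 2 x k (solve₂ n) (s≤s z≤n) 1≤k ⟩
      1 * r + 2 * k                   ≡⟨ solve₃ r k ⟩
      (k + r) + k                     ≤⟨ +-monoʳ-≤ (k + r) (s≤s⁻¹ (≰⇒> m≮k)) ⟩
      (k + r) + m                     ∎)
    where
    open ≤-Reasoning
    r = (k * x) % p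
    solve₁ : ∀ m → suc m + m ≡ suc (m * 2)
    solve₁ = solve-∀
    solve₂ : ∀ n → 1 * suc (n * 2) + 2 ≡ suc (suc n * 2)
    solve₂ = solve-∀
    solve₃ : ∀ r k → 1 * r + 2 * k ≡ (k + r) + k
    solve₃ = solve-∀

1+n≤height[1+n,n] : ∀ {n} → 1 ≤ n → suc n ≤ height (suc n) n
1+n≤height[1+n,n] {n} 1≤n = height-greatest (suc n) n (s≤s 1≤n) lower
  where
  lower : ∀ k → 1 ≤ k → suc n ≤ heightAt (suc n) n k
  lower k 1≤k = begin
    suc n                   ≤⟨ c*x+d≡p⇒p≤c*r+d*k 1 1 n k (solve n) ≤-refl 1≤k ⟩
    1 * r + 1 * k           ≡⟨ solve′ r k ⟩
    k + r                   ∎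
    where
    open ≤-Reasoning
    r = (k * n) % suc n
    solve : ∀ n → 1 * n + 1 ≡ suc n
    solve = solve-∀
    solve′ : ∀ r k → 1 * r + 1 * k ≡ k + r
    solve′ = solve-∀

2≤quotient : ∀ {r b k} → r < b → b * 2 ≤ r + k * b → 2 ≤ k
2≤quotient {r} {b} {k} r<b 2b≤r+kb = s≤s⁻¹ (*-cancelʳ-< b 2 (suc k) (begin-strict
  2 * b     ≡⟨ *-comm 2 b ⟩
  b * 2     ≤⟨ 2b≤r+kb ⟩
  r + k * b <⟨ +-monoˡ-< (k * b) r<b ⟩
  b + k * b ∎))
  where open ≤-Reasoning

[q+r]*2≤r+q*b : ∀ {r b q} → r < b → 3 ≤ b → 2 ≤ q → (q + r) * 2 ≤ r + q * b
[q+r]*2≤r+q*b {r} {b@(suc (suc (suc c)))} {q} r<b (s≤s (s≤s (s≤s _))) 2≤q = begin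
  (q + r) * 2             ≡⟨ regroup q r ⟩
  r + (q * 2 + r)         ≤⟨ +-monoʳ-≤ r (+-monoʳ-≤ (q * 2) r≤q*[b∸2]) ⟩
  r + (q * 2 + q * suc c) ≡⟨ cong (r +_) (sym (*-distribˡ-+ q 2 (suc c))) ⟩
  r + q * b               ∎
  where
  open ≤-Reasoning
  regroup : ∀ q r → (q + r) * 2 ≡ r + (q * 2 + r)
  regroup = solve-∀
  r≤q*[b∸2] : r ≤ q * suc c
  r≤q*[b∸2] = begin
    r             ≤⟨ s≤s⁻¹ r<b ⟩
    suc (suc c)   ≤⟨ s≤s (m≤n+m (suc c) c) ⟩
    suc c + suc c ≡⟨ cong (suc c +_) (sym (+-identityʳ (suc c))) ⟩
    2 * suc c     ≤⟨ *-monoˡ-≤ (suc c) 2≤q ⟩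
    q * suc c     ∎

x+b≡p⇒[1+q]*x≡r+q*p : ∀ {x b p r} q → x + b ≡ p → r + suc q * b ≡ p → suc q * x ≡ r + q * p
x+b≡p⇒[1+q]*x≡r+q*p {x} {b} {p} {r} q x+b≡p r+[1+q]*b≡p = +-cancelʳ-≡ (suc q * b) _ _ (begin
  suc q * x + suc q * b   ≡⟨ sym (*-distribˡ-+ (suc q) x b) ⟩
  suc q * (x + b)         ≡⟨ cong (suc q *_) x+b≡p ⟩
  p + q * p               ≡⟨ cong (_+ q * p) (sym r+[1+q]*b≡p) ⟩
  r + suc q * b + q * p   ≡⟨ swap r (suc q * b) (q * p) ⟩
  r + q * p + suc q * b   ∎)
  where
  open ≡-Reasoning
  swap : ∀ a b c → a + b + c ≡ a + c + b
  swap = solve-∀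

height*2≤ : ∀ {p} .{{_ : NonZero p}} {x b} → x + b ≡ p → 3 ≤ b → b * 2 ≤ p → height p x * 2 ≤ p
height*2≤ {p} {x} {b@(suc _)} x+b≡p 3≤b 2b≤p =
  bound (p / b) (m%n<n p b) division (2≤quotient (m%n<n p b) (≤-trans 2b≤p (≤-reflexive division)))
  where
  division : p ≡ p % b + (p / b) * b
  division = m≡m%n+[m/n]*n p b
  bound : ∀ {r} q → r < b → p ≡ r + q * b → 2 ≤ q → height p x * 2 ≤ p
  bound {r} (suc q) r<b p≡r+qb 2≤q = begin
    height p x * 2           ≤⟨ *-monoˡ-≤ 2 (height-≤ p x (s≤s z≤n) 1+q<p) ⟩
    heightAt p x (suc q) * 2 ≡⟨ cong (λ t → (suc q + t) * 2) residue ⟩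
    (suc q + r) * 2          ≤⟨ [q+r]*2≤r+q*b r<b 3≤b 2≤q ⟩
    r + suc q * b            ≡⟨ sym p≡r+qb ⟩
    p                        ∎
    where
    open ≤-Reasoning
    r<p : r < p
    r<p = <-≤-trans r<b (≤-trans (m≤m*n b 2) 2b≤p)
    residue : (suc q * x) % p ≡ r
    residue = m≡r+q*n⇒m%n≡r r q (x+b≡p⇒[1+q]*x≡r+q*p q x+b≡p (sym p≡r+qb)) r<p
    1+q<p : suc q < p
    1+q<p = begin-strict
      suc q         <⟨ m<m*n (suc q) b (≤-trans (s≤s (s≤s z≤n)) 3≤b) ⟩
      suc q * b     ≤⟨ m≤n+m _ r ⟩
      r + suc q * b ≡⟨ sym p≡r+qb ⟩
      p             ∎

n*2≤1+m*2⇒n≤m : ∀ {n m} → n * 2 ≤ suc (m * 2) → n ≤ m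
n*2≤1+m*2⇒n≤m {n} {m} n*2≤1+m*2 = s≤s⁻¹ (*-cancelʳ-< 2 n (suc m) (s≤s n*2≤1+m*2))

height≤half : ∀ {m x} → x < suc (m * 2) → x ≢ m → x ≢ m * 2 ∸ 1 → x ≢ m * 2 →
              height (suc (m * 2)) x ≤ m
height≤half {m} {x} x<p x≢m x≢p∸2 x≢p∸1 with x <? m
... | yes x<m = begin
  height p x     ≤⟨ height-≤ p x ≤-refl (s≤s (≤-trans (≤-trans (s≤s z≤n) x<m) (m≤m*n m 2))) ⟩
  heightAt p x 1 ≡⟨ heightAt-1 x<p ⟩
  suc x          ≤⟨ x<m ⟩
  m              ∎
  where
  open ≤-Reasoning
  p = suc (m * 2)
... | no x≮m = complement (m≤n⇒∃[o]m+o≡n x<p)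
  where
  p = suc (m * 2)
  m<x : m < x
  m<x = ≤∧≢⇒< (≮⇒≥ x≮m) (λ m≡x → x≢m (sym m≡x))
  complement : ∃[ o ] suc x + o ≡ p → height p x ≤ m
  complement (zero , 1+x+0≡p) =
    contradiction (suc-injective (trans (sym (+-identityʳ (suc x))) 1+x+0≡p)) x≢p∸1
  complement (suc zero , 1+x+1≡p) =
    contradiction (trans (sym (m+n∸n≡m x 1)) (cong (_∸ 1) (suc-injective 1+x+1≡p))) x≢p∸2
  complement (suc (suc c) , 1+x+o≡p) = n*2≤1+m*2⇒n≤m (height*2≤ x+b≡p (s≤s (s≤s (s≤s z≤n))) b*2≤p)
    where
    b = suc (suc (suc c))
    x+b≡p : x + b ≡ p
    x+b≡p = trans (+-suc x (suc (suc c))) 1+x+o≡p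
    b≤m : b ≤ m
    b≤m = +-cancelˡ-≤ (suc m) b m (begin
      suc m + b   ≤⟨ +-monoˡ-≤ b m<x ⟩
      x + b       ≡⟨ x+b≡p ⟩
      suc (m * 2) ≡⟨ cong suc (solve m) ⟩
      suc m + m   ∎)
      where
      open ≤-Reasoning
      solve : ∀ m → m * 2 ≡ m + m
      solve = solve-∀
    b*2≤p : b * 2 ≤ p
    b*2≤p = m≤n⇒m≤1+n (*-monoˡ-≤ 2 b≤m)

height≡1+m⇒ : ∀ {m x} → 1 ≤ m → x < suc (m * 2) → height (suc (m * 2)) x ≡ suc m →
              x ≡ m ⊎ x ≡ m * 2 ∸ 1
height≡1+m⇒ {m} {x} 1≤m x<p h≡1+m with x ≟ m | x ≟ m * 2 ∸ 1 | x ≟ m * 2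
... | yes x≡m | _         | _    = inj₁ x≡m
... | no _    | yes x≡p∸2 | _    = inj₂ x≡p∸2
... | no _    | no _      | yes refl =
  contradiction (s≤s⁻¹ (≤-trans (1+n≤height[1+n,n] (≤-trans 1≤m (m≤m*n m 2))) (≤-reflexive h≡1+m)))
                (<⇒≱ (m<m*n m 2 {{>-nonZero 1≤m}} ≤-refl))
... | no x≢m  | no x≢p∸2  | no x≢p∸1 =
  contradiction (≤-trans (≤-reflexive (sym h≡1+m)) (height≤half x<p x≢m x≢p∸2 x≢p∸1)) (n≮n m)

height≡1+m⇐ : ∀ {m x} → 1 ≤ m → x ≡ m ⊎ x ≡ m * 2 ∸ 1 → height (suc (m * 2)) x ≡ suc m
height≡1+m⇐ 1≤m (inj₁ refl) = height-half 1≤m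
height≡1+m⇐ 1≤m (inj₂ refl) = height-minus2 1≤m

odd-prime⇒≡1+m*2 : ∀ {p} → Prime p → p ≢ 2 → ∃[ m ] 1 ≤ m × p ≡ suc (m * 2)
odd-prime⇒≡1+m*2 {p} pr p≢2 = parity (p % 2) (p / 2) (m%n<n p 2) (m≡m%n+[m/n]*n p 2)
  where
  parity : ∀ r q → r < 2 → p ≡ r + q * 2 → ∃[ m ] 1 ≤ m × p ≡ suc (m * 2)
  parity 0 q _ p≡q*2 with prime⇒irreducible pr (divides q p≡q*2)
  ... | inj₂ 2≡p = contradiction (sym 2≡p) p≢2
  parity 1 0       _ p≡1 = contradiction p≡1 (nonTrivial⇒≢1 {{prime⇒nonTrivial pr}})
  parity 1 (suc q) _ p≡1+q*2 = suc q , s≤s z≤n , p≡1+q*2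
  parity (suc (suc _)) _ (s≤s (s≤s ())) _

[1+m*2+1]/2≡1+m : ∀ m → (suc (m * 2) + 1) / 2 ≡ suc m
[1+m*2+1]/2≡1+m m = trans (cong (_/ 2) (+-comm (suc (m * 2)) 1)) (m*n/n≡m (suc m) 2)

theorem1 : (p : ℕ) .{{_ : NonZero p}} → Prime p → p ≢ 2 → (a : Fin p) →
    ((h1 p a ≡ (p + 1) / 2 → (toℕ a ≡ (p ∸ 1) / 2 ⊎ toℕ a ≡ p ∸ 2))
    × ((toℕ a ≡ (p ∸ 1) / 2 ⊎ toℕ a ≡ p ∸ 2) → h1 p a ≡ (p + 1) / 2))
    × (toℕ a ≢ (p ∸ 1) / 2 → toℕ a ≢ p ∸ 2 → toℕ a ≢ p ∸ 1 → h1 p a ≤ (p ∸ 1) / 2)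
theorem1 p pr p≢2 a with odd-prime⇒≡1+m*2 pr p≢2
... | m , 1≤m , refl rewrite [1+m*2+1]/2≡1+m m | m*n/n≡m m 2 {{_}} =
  (height≡1+m⇒ 1≤m (toℕ<n a) , height≡1+m⇐ 1≤m) , height≤half (toℕ<n a)
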